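{- (1) If $i_1,\ldots,i_p$ are $p$ positive integers summing to $l$ and $n=\sum_{j=1}^{p-2}(p-1-j)i_j$, then $\phi_l^n([i_1,i_2,\ldots,i_p])=Y_{l-i_p}$. (2) For any $0\leq j\leq l-1$, $\phi_k^{l-k}(Y_j)=X_{(k-l+j)_+}$, where $(n)_+=\max(n,0)$.
   Context: Fix integers $2\leq k<l$. For $n\geq1$, an $n$-configuration is a sequence of nonnegative integers $(X(i))_{i\in\mathbb{Z}_- }$ (number of balls in bin $i$) with $\sum_i X(i)=n$ and such that for some $p\geq1$, $X(i)>0$ iff $i>-p$; it is written as the tuple $[X(-p+1),\ldots,X(0)]$ (bin $0$ is the rightmost). For $k\leq n$, the move $\phi_k$ acts on an $n$-configuration $X$ as follows: counting balls from right to left, add one ball to the bin immediately to the right of the bin containing the $k$-th ball, then delete one ball from the leftmost bin; if the $k$-th ball is already in the rightmost bin, create a new bin immediately to its right containing one ball and relabel the bins so the new bin has label $0$ (then delete one ball from the leftmost bin). Powers $\phi^m$ denote $m$-fold composition. All configurations here are $l$-configurations. Define $Y_0=[l]$ and $Y_j=[j,l-j]$ for $1\leq j\leq l-1$. Write $l=kd+r$ with integers $d\geq1$ and $1\leq r\leq k$. Define $X_0=[k,\ldots,k,r]$ ($d$ bins with $k$ balls, then a rightmost bin with $r$ balls); for $1\leq i\leq r-1$, $X_i=[i,k,\ldots,k,r-i]$ with $d$ bins containing $k$ balls in the middle; for $r\leq i\leq k-1$, $X_i=[i,k,\ldots,k,k+r-i]$ with $d-1$ bins containing $k$ balls in the middle.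 -}

module Defs where

open import Data.Nat using (ℕ; zero; suc; _+_; _*_; _∸_; _≤ᵇ_; _<ᵇ_)
open import Data.Bool using (if_then_else_)
open import Data.List using (List; []; _∷_; reverse; replicate; _++_; length)

-- A configuration is written as the list [X(-p+1), ..., X(0)]
-- (leftmost bin first, rightmost bin 0 last), as in the paper.
Config : Set
Config = List ℕ

-- Right-to-left helpers (list given rightmost bin first).
-- go k x ys : x is the bin just to the right of the bins ys; we look for
-- the k-th ball (counted inside ys), and add a ball to x if found in the
-- head of ys.
go : ℕ → ℕ → List ℕ → List ℕ
go k x [] = x ∷ []
go k x (y ∷ ys) = if k ≤ᵇ y then suc x ∷ y ∷ ys else x ∷ go (k ∸ y) y ys

-- add one ball to the bin immediately to the right of the bin containing
-- the k-th ball counted from the right; if that bin is the rightmost one,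
-- create a new rightmost bin with one ball. (Input: rightmost bin first.)
addBall : ℕ → List ℕ → List ℕ
addBall k [] = []
addBall k (x ∷ xs) = if k ≤ᵇ x then 1 ∷ x ∷ xs else go (k ∸ x) x xs

delLeft : List ℕ → List ℕ
delLeft [] = []
delLeft (zero ∷ xs) = xs
delLeft (suc zero ∷ xs) = xs
delLeft (suc (suc a) ∷ xs) = suc a ∷ xs

φ : ℕ → Config → Config
φ k X = delLeft (reverse (addBall k (reverse X)))

iter : {A : Set} → (A → A) → ℕ → A → A
iter f zero a = a
iter f (suc m) a = f (iter f m a)

-- For [i_1,...,i_p], weight = Σ_{j=1}^{p-2} (p-1-j) i_j.
-- Recursively: i_1 has coefficient p-2 = (length of tail) - 1; the
-- coefficients of i_{p-1}, i_p are 0 (truncated subtraction).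
weight : List ℕ → ℕ
weight [] = 0
weight (x ∷ xs) = (length xs ∸ 1) * x + weight xs

Y : ℕ → ℕ → Config
Y l zero = l ∷ []
Y l (suc j) = suc j ∷ (l ∸ suc j) ∷ []

-- X_i for l = k d + r (parameters k d r given explicitly)
X : ℕ → ℕ → ℕ → ℕ → Config
X k d r zero = replicate d k ++ (r ∷ [])
X k d r (suc i) =
  if suc i <ᵇ r
  then suc i ∷ (replicate d k ++ ((r ∸ suc i) ∷ []))
  else suc i ∷ (replicate (d ∸ 1) k ++ ((k + r ∸ suc i) ∷ []))

-- When the bins hold l balls in all, the l-th ball from the right is a ball of the leftmost bin,
-- so φ_l moves one ball from the first bin into the second. Emptying the first bin thus takes
-- i_1 moves and merges the first two bins, and the weight adds up these moves until only the
-- last two bins are left.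
--
-- For φ_k call a configuration packed when, behind its first bin, the remaining balls fill bins
-- of capacity k from the left: [x, k, …, k, c] with 1 ≤ c ≤ k. As long as the k-th ball from the
-- right lies in the first bin, or in a bin with at least k balls right after it, φ_k moves one
-- ball from the first bin into this canonical tail, keeping it canonical. The configuration
-- Y_j is packed if l - j ≤ k; otherwise emptying its first bin j makes it packed. The
-- remaining moves then run down the first bin, and X_i is the packed configuration with first
-- bin i (with first bin k for i = 0).
module Submission where

open import Defs
open import Data.Bool using (if_then_else_)
open import Data.List using (List; []; _∷_; _∷ʳ_; _++_; reverse; replicate; length)
open import Data.List.Properties using (reverse-++; unfold-reverse; reverse-involutive; ++-assoc; length-++)
open import Data.List.Relation.Binary.Permutation.Propositional.Properties using (↭-reverse)
open import Data.List.Relation.Unary.All using (All) renaming (head to All-head)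
open import Data.Nat using (ℕ; zero; suc; _+_; _*_; _∸_; _≤_; _<_; _≤ᵇ_; _≤?_; _<?_; z≤n; s≤s; >-nonZero)
open import Data.Nat.DivMod using (_/_; _%_; m≡m%n+[m/n]*n; m%n<n)
open import Data.Nat.ListAction using (sum)
open import Data.Nat.ListAction.Properties using (sum-↭)
open import Data.Nat.Properties
open import Data.Nat.Tactic.RingSolver using (solve-∀; solve)
open import Data.Product using (Σ; _×_; _,_)
open import Relation.Nullary.Decidable using (yes; no; dec-true; dec-false)
open import Relation.Binary.PropositionalEquality
open ≡-Reasoning

iter-suc : {A : Set} (f : A → A) (m : ℕ) (x : A) → iter f (suc m) x ≡ iter f m (f x)
iter-suc f zero    x = refl
iter-suc f (suc m) x = cong f (iter-suc f m x)

iter-+ : {A : Set} (f : A → A) (m n : ℕ) (x : A) → iter f (m + n) x ≡ iter f m (iter f n x)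
iter-+ f zero    n x = refl
iter-+ f (suc m) n x = cong f (iter-+ f m n x)

reverse-++-∷ : {A : Set} (xs : List A) (x : A) (ys : List A) →
               reverse (xs ++ x ∷ ys) ≡ reverse ys ++ x ∷ reverse xs
reverse-++-∷ xs x ys = begin
  reverse (xs ++ x ∷ ys)          ≡⟨ reverse-++ xs (x ∷ ys) ⟩
  reverse (x ∷ ys) ++ reverse xs  ≡⟨ cong (_++ reverse xs) (unfold-reverse x ys) ⟩
  (reverse ys ∷ʳ x) ++ reverse xs ≡⟨ ++-assoc (reverse ys) (x ∷ []) (reverse xs) ⟩
  reverse ys ++ x ∷ reverse xs    ∎

replicate-∷ʳ : {A : Set} (n : ℕ) (x : A) → replicate n x ∷ʳ x ≡ x ∷ replicate n x
replicate-∷ʳ zero    x = refl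
replicate-∷ʳ (suc n) x = cong (x ∷_) (replicate-∷ʳ n x)

reverse-replicate : {A : Set} (n : ℕ) (x : A) → reverse (replicate n x) ≡ replicate n x
reverse-replicate zero    x = refl
reverse-replicate (suc n) x = begin
  reverse (x ∷ replicate n x)   ≡⟨ unfold-reverse x (replicate n x) ⟩
  reverse (replicate n x) ∷ʳ x  ≡⟨ cong (_∷ʳ x) (reverse-replicate n x) ⟩
  replicate n x ∷ʳ x            ≡⟨ replicate-∷ʳ n x ⟩
  x ∷ replicate n x             ∎

last≤sum : ∀ xs z → z ≤ sum (xs ∷ʳ z)
last≤sum []       z = m≤m+n z 0
last≤sum (x ∷ xs) z = ≤-trans (last≤sum xs z) (m≤n+m _ x)

φ-reverse : ∀ {k} xs ys → addBall k (reverse xs) ≡ reverse ys → φ k xs ≡ delLeft ys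
φ-reverse xs ys eq = trans (cong (λ zs → delLeft (reverse zs)) eq) (cong delLeft (reverse-involutive ys))

addBall-here : ∀ {k c} cs → k ≤ c → addBall k (c ∷ cs) ≡ 1 ∷ c ∷ cs
addBall-here {k} {c} cs k≤c rewrite dec-true (k ≤? c) k≤c = refl

next-bin : ∀ {k} z zs b y → sum (z ∷ zs) + b < k → k ≤ sum (z ∷ zs) + b + y →
           z < k × sum zs + b < k ∸ z × k ∸ z ≤ sum zs + b + y
next-bin {k} z zs b y lt le = z<k , lt′ , le′
  where
  z<k : z < k
  z<k = ≤-<-trans (≤-trans (m≤m+n z (sum zs)) (m≤m+n (z + sum zs) b)) lt
  lt′ : sum zs + b < k ∸ z
  lt′ = +-cancelˡ-< z _ _ (subst₂ _<_ (+-assoc z (sum zs) b) (sym (m+[n∸m]≡n (<⇒≤ z<k))) lt)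
  le′ : k ∸ z ≤ sum zs + b + y
  le′ = m≤n+o⇒m∸n≤o k z
          (subst (k ≤_) (trans (cong (_+ y) (+-assoc z (sum zs) b)) (+-assoc z (sum zs + b) y)) le)

go-into : ∀ {k} x zs b {y} R → sum zs + b < k → k ≤ sum zs + b + y →
          go k x (zs ++ b ∷ y ∷ R) ≡ x ∷ zs ++ suc b ∷ y ∷ R
go-into {k} x [] b {y} R b<k k≤b+y
  rewrite dec-false (k ≤? b) (<⇒≱ b<k) | dec-true (k ∸ b ≤? y) (m≤n+o⇒m∸n≤o k b k≤b+y) = refl
go-into {k} x (z ∷ zs) b {y} R lt le with next-bin z zs b y lt le
... | z<k , lt′ , le′ rewrite dec-false (k ≤? z) (<⇒≱ z<k) = cong (x ∷_) (go-into z zs b R lt′ le′)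

-- The list is read rightmost bin first; the hypotheses say that the k-th ball lies in bin y.
addBall-into : ∀ {k} zs b {y} R → sum zs + b < k → k ≤ sum zs + b + y →
               addBall k (zs ++ b ∷ y ∷ R) ≡ zs ++ suc b ∷ y ∷ R
addBall-into {k} [] b {y} R b<k k≤b+y
  rewrite dec-false (k ≤? b) (<⇒≱ b<k) | dec-true (k ∸ b ≤? y) (m≤n+o⇒m∸n≤o k b k≤b+y) = refl
addBall-into {k} (z ∷ zs) b {y} R lt le with next-bin z zs b y lt le
... | z<k , lt′ , le′ rewrite dec-false (k ≤? z) (<⇒≱ z<k) = go-into z zs b R lt′ le′

φ-move : ∀ {l c b} rest → 1 ≤ c → sum (c ∷ b ∷ rest) ≡ l →
         φ l (c ∷ b ∷ rest) ≡ delLeft (c ∷ suc b ∷ rest)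
φ-move {l} {c} {b} rest 1≤c refl = φ-reverse (c ∷ b ∷ rest) (c ∷ suc b ∷ rest) (begin
  addBall l (reverse ((c ∷ []) ++ b ∷ rest)) ≡⟨ cong (addBall l) (reverse-++-∷ (c ∷ []) b rest) ⟩
  addBall l (reverse rest ++ b ∷ c ∷ [])     ≡⟨ addBall-into (reverse rest) b [] b<l (≤-reflexive (sym total)) ⟩
  reverse rest ++ suc b ∷ c ∷ []             ≡⟨ reverse-++-∷ (c ∷ []) (suc b) rest ⟨
  reverse (c ∷ suc b ∷ rest)                 ∎)
  where
  rearrange : ∀ s → s + b + c ≡ c + (b + s)
  rearrange s = solve (s ∷ b ∷ c ∷ [])
  total : sum (reverse rest) + b + c ≡ l
  total = trans (cong (λ s → s + b + c) (sum-↭ (↭-reverse rest))) (rearrange (sum rest))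
  b<l : sum (reverse rest) + b < l
  b<l = subst (sum (reverse rest) + b <_) total (m<m+n _ 1≤c)

iter-φ-merge : ∀ {l} a b rest → sum (suc a ∷ b ∷ rest) ≡ l →
               iter (φ l) (suc a) (suc a ∷ b ∷ rest) ≡ suc a + b ∷ rest
iter-φ-merge zero b rest total = φ-move rest (s≤s z≤n) total
iter-φ-merge {l} (suc a) b rest total = begin
  iter (φ l) (suc (suc a)) (suc (suc a) ∷ b ∷ rest)
    ≡⟨ iter-suc (φ l) (suc a) _ ⟩
  iter (φ l) (suc a) (φ l (suc (suc a) ∷ b ∷ rest))
    ≡⟨ cong (iter (φ l) (suc a)) (φ-move rest (s≤s z≤n) total) ⟩
  iter (φ l) (suc a) (suc a ∷ suc b ∷ rest)
    ≡⟨ iter-φ-merge a (suc b) rest (trans (cong suc (+-suc a (b + sum rest))) total) ⟩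
  suc a + suc b ∷ rest
    ≡⟨ cong (_∷ rest) (+-suc (suc a) b) ⟩
  suc (suc a) + b ∷ rest ∎

weight-merge : ∀ a b xs z → weight (a ∷ b ∷ (xs ∷ʳ z)) ≡ weight (a + b ∷ (xs ∷ʳ z)) + a
weight-merge a b xs z rewrite length-++ xs {z ∷ []} | +-comm (length xs) 1 =
  shuffle (length xs) (weight (xs ∷ʳ z))
  where
  shuffle : ∀ n w → suc n * a + (n * b + w) ≡ n * (a + b) + w + a
  shuffle n w = solve (n ∷ w ∷ a ∷ b ∷ [])

collapse : ∀ {l} x xs z → 1 ≤ x → sum (x ∷ (xs ∷ʳ z)) ≡ l →
           iter (φ l) (weight (x ∷ (xs ∷ʳ z))) (x ∷ (xs ∷ʳ z)) ≡ l ∸ z ∷ z ∷ []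
collapse x [] z _ refl rewrite +-identityʳ z | m+n∸n≡m x z = refl
collapse {l} (suc a) (y ∷ xs) z _ total = begin
  iter (φ l) (weight (suc a ∷ y ∷ R)) (suc a ∷ y ∷ R)
    ≡⟨ cong (λ n → iter (φ l) n (suc a ∷ y ∷ R)) (weight-merge (suc a) y xs z) ⟩
  iter (φ l) (weight (suc a + y ∷ R) + suc a) (suc a ∷ y ∷ R)
    ≡⟨ iter-+ (φ l) (weight (suc a + y ∷ R)) (suc a) _ ⟩
  iter (φ l) (weight (suc a + y ∷ R)) (iter (φ l) (suc a) (suc a ∷ y ∷ R))
    ≡⟨ cong (iter (φ l) (weight (suc a + y ∷ R))) (iter-φ-merge a y R total) ⟩
  iter (φ l) (weight (suc a + y ∷ R)) (suc a + y ∷ R)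
    ≡⟨ collapse (suc a + y) xs z (s≤s z≤n) (trans (+-assoc (suc a) y (sum R)) total) ⟩
  l ∸ z ∷ z ∷ [] ∎
  where
  R = xs ∷ʳ z

Y-pair : ∀ {l z} → z < l → Y l (l ∸ z) ≡ l ∸ z ∷ z ∷ []
Y-pair {l} {z} z<l with l ∸ z | m<n⇒0<n∸m z<l | m∸[m∸n]≡n (<⇒≤ z<l)
... | suc s | _ | l∸s≡z = cong (λ w → suc s ∷ w ∷ []) l∸s≡z

iter-φ-weight : ∀ {l} is z → All (1 ≤_) (is ∷ʳ z) → sum (is ∷ʳ z) ≡ l →
                iter (φ l) (weight (is ∷ʳ z)) (is ∷ʳ z) ≡ Y l (l ∸ z)
iter-φ-weight [] z _ refl rewrite +-identityʳ z | n∸n≡0 z = refl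
iter-φ-weight (x ∷ xs) z pos total = trans (collapse x xs z 1≤x total) (sym (Y-pair z<l))
  where
  1≤x = All-head pos
  z<l = subst (z <_) total (<-≤-trans (m<n+m z 1≤x) (+-monoʳ-≤ x (last≤sum xs z)))

bump : ℕ → List ℕ → List ℕ
bump k []       = 1 ∷ []
bump k (c ∷ cs) = if k ≤ᵇ c then 1 ∷ c ∷ cs else suc c ∷ cs

-- n balls filling bins of capacity k from the left, [k, …, k, c] with 1 ≤ c ≤ k, listed
-- rightmost bin first.
blocksʳ : ℕ → ℕ → List ℕ
blocksʳ k n = iter (bump k) n []

blocks : ℕ → ℕ → List ℕ
blocks k n = reverse (blocksʳ k n)

packed : ℕ → ℕ → ℕ → Config
packed k l x = x ∷ blocks k (l ∸ x)

bump-here : ∀ {k c} cs → k ≤ c → bump k (c ∷ cs) ≡ 1 ∷ c ∷ cs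
bump-here {k} {c} cs k≤c rewrite dec-true (k ≤? c) k≤c = refl

bump-next : ∀ {k c} cs → c < k → bump k (c ∷ cs) ≡ suc c ∷ cs
bump-next {k} {c} cs c<k rewrite dec-false (k ≤? c) (<⇒≱ c<k) = refl

blocksʳ-canonical : ∀ {k} q c → 1 ≤ c → c ≤ k → blocksʳ k (q * k + c) ≡ c ∷ replicate q k
blocksʳ-canonical zero (suc zero) _ _ = refl
blocksʳ-canonical {k} (suc q) (suc zero) _ 1≤k = begin
  blocksʳ k (suc q * k + 1)
    ≡⟨ cong (blocksʳ k) (trans (+-comm (suc q * k) 1) (cong suc (+-comm k (q * k)))) ⟩
  bump k (blocksʳ k (q * k + k))
    ≡⟨ cong (bump k) (blocksʳ-canonical q k 1≤k ≤-refl) ⟩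
  bump k (k ∷ replicate q k)
    ≡⟨ bump-here (replicate q k) ≤-refl ⟩
  1 ∷ replicate (suc q) k ∎
blocksʳ-canonical {k} q (suc (suc c)) _ c<k = begin
  blocksʳ k (q * k + suc (suc c))
    ≡⟨ cong (blocksʳ k) (+-suc (q * k) (suc c)) ⟩
  bump k (blocksʳ k (q * k + suc c))
    ≡⟨ cong (bump k) (blocksʳ-canonical q (suc c) (s≤s z≤n) (<⇒≤ c<k)) ⟩
  bump k (suc c ∷ replicate q k)
    ≡⟨ bump-next (replicate q k) c<k ⟩
  suc (suc c) ∷ replicate q k ∎

blocks-canonical : ∀ {k} q c → 1 ≤ c → c ≤ k → blocks k (q * k + c) ≡ replicate q k ++ c ∷ []
blocks-canonical {k} q c 1≤c c≤k = begin
  reverse (blocksʳ k (q * k + c))  ≡⟨ cong reverse (blocksʳ-canonical q c 1≤c c≤k) ⟩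
  reverse (c ∷ replicate q k)      ≡⟨ unfold-reverse c (replicate q k) ⟩
  reverse (replicate q k) ∷ʳ c     ≡⟨ cong (_∷ʳ c) (reverse-replicate q k) ⟩
  replicate q k ∷ʳ c               ∎

blocksʳ-shape : ∀ {k} → 0 < k → ∀ m →
                Σ ℕ λ q → Σ ℕ λ c → q * k + c ≡ suc m × blocksʳ k (suc m) ≡ c ∷ replicate q k
blocksʳ-shape {k} 0<k m = q , c , split , subst (λ n → blocksʳ k n ≡ c ∷ replicate q k) split canonical
  where
  instance _ = >-nonZero 0<k
  q = m / k
  c = suc (m % k)
  split : q * k + c ≡ suc m
  split = trans (+-suc (q * k) (m % k))
                (cong suc (trans (+-comm (q * k) (m % k)) (sym (m≡m%n+[m/n]*n m k))))
  canonical : blocksʳ k (q * k + c) ≡ c ∷ replicate q k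
  canonical = blocksʳ-canonical q c (s≤s z≤n) (m%n<n m k)

addBall-bump : ∀ {k} q c x R → k ≤ (q * k + c) + x →
               addBall k (c ∷ replicate q k ++ x ∷ R) ≡ bump k (c ∷ replicate q k) ++ x ∷ R
addBall-bump {k} q c x R le with k ≤? c
... | yes k≤c = trans (addBall-here _ k≤c) (cong (_++ x ∷ R) (sym (bump-here _ k≤c)))
... | no k≰c = trans (into q le) (cong (_++ x ∷ R) (sym (bump-next _ c<k)))
  where
  c<k = ≰⇒> k≰c
  into : ∀ q → k ≤ (q * k + c) + x →
         addBall k (c ∷ replicate q k ++ x ∷ R) ≡ suc c ∷ replicate q k ++ x ∷ R
  into zero    k≤c+x = addBall-into [] c R c<k k≤c+x
  into (suc q) _     = addBall-into [] c _ c<k (m≤n+m k c)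

addBall-blocksʳ : ∀ {k} → 0 < k → ∀ n x R → k ≤ n + x →
                  addBall k (blocksʳ k n ++ x ∷ R) ≡ blocksʳ k (suc n) ++ x ∷ R
addBall-blocksʳ _ zero x R k≤x = addBall-here R k≤x
addBall-blocksʳ {k} 0<k (suc m) x R le with blocksʳ-shape 0<k m
... | q , c , split , shape = begin
  addBall k (blocksʳ k (suc m) ++ x ∷ R)  ≡⟨ cong (λ cs → addBall k (cs ++ x ∷ R)) shape ⟩
  addBall k (c ∷ replicate q k ++ x ∷ R)  ≡⟨ addBall-bump q c x R (subst (λ n → k ≤ n + x) (sym split) le) ⟩
  bump k (c ∷ replicate q k) ++ x ∷ R     ≡⟨ cong (λ cs → bump k cs ++ x ∷ R) shape ⟨
  blocksʳ k (suc (suc m)) ++ x ∷ R        ∎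

-- k ≤ n + x: the k-th ball from the right is not to the left of bin x.
φ-feed : ∀ {k} → 0 < k → ∀ P x n → k ≤ n + x →
         φ k (P ++ x ∷ blocks k n) ≡ delLeft (P ++ x ∷ blocks k (suc n))
φ-feed {k} 0<k P x n le = φ-reverse (P ++ x ∷ blocks k n) (P ++ x ∷ blocks k (suc n)) (begin
  addBall k (reverse (P ++ x ∷ blocks k n))
    ≡⟨ cong (addBall k) (reverse-++-∷ P x (blocks k n)) ⟩
  addBall k (reverse (blocks k n) ++ x ∷ reverse P)
    ≡⟨ cong (λ cs → addBall k (cs ++ x ∷ reverse P)) (reverse-involutive (blocksʳ k n)) ⟩
  addBall k (blocksʳ k n ++ x ∷ reverse P)
    ≡⟨ addBall-blocksʳ 0<k n x (reverse P) le ⟩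
  blocksʳ k (suc n) ++ x ∷ reverse P
    ≡⟨ cong (_++ x ∷ reverse P) (reverse-involutive (blocksʳ k (suc n))) ⟨
  reverse (blocks k (suc n)) ++ x ∷ reverse P
    ≡⟨ reverse-++-∷ P x (blocks k (suc n)) ⟨
  reverse (P ++ x ∷ blocks k (suc n)) ∎)

φ-packed : ∀ {k l} → 0 < k → k ≤ l → ∀ y → 1 ≤ y → y < l → φ k (packed k l (suc y)) ≡ packed k l y
φ-packed {k} {l} 0<k k≤l (suc y) _ y<l = begin
  φ k (packed k l (suc (suc y)))
    ≡⟨ φ-feed 0<k [] (suc (suc y)) (l ∸ suc (suc y)) (subst (k ≤_) (sym (m∸n+n≡m y<l)) k≤l) ⟩
  suc y ∷ blocks k (suc (l ∸ suc (suc y)))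
    ≡⟨ cong (λ n → suc y ∷ blocks k n) (+-∸-assoc 1 y<l) ⟨
  packed k l (suc y) ∎

iter-φ-packed : ∀ {k l} → 0 < k → k ≤ l → ∀ m x → 1 ≤ x → m + x ≤ l →
                iter (φ k) m (packed k l (m + x)) ≡ packed k l x
iter-φ-packed _ _ zero x _ _ = refl
iter-φ-packed {k} {l} 0<k k≤l (suc m) x 1≤x le = begin
  iter (φ k) (suc m) (packed k l (suc m + x))
    ≡⟨ iter-suc (φ k) m _ ⟩
  iter (φ k) m (φ k (packed k l (suc m + x)))
    ≡⟨ cong (iter (φ k) m) (φ-packed 0<k k≤l (m + x) (≤-trans 1≤x (m≤n+m x m)) le) ⟩
  iter (φ k) m (packed k l (m + x))
    ≡⟨ iter-φ-packed 0<k k≤l m x 1≤x (<⇒≤ le) ⟩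
  packed k l x ∎

iter-φ-empty-first : ∀ {k B} → 0 < k → k ≤ B → ∀ m n →
                     iter (φ k) (suc m) (suc m ∷ B ∷ blocks k n) ≡ B ∷ blocks k (suc m + n)
iter-φ-empty-first {k} {B} 0<k k≤B zero n = φ-feed 0<k (1 ∷ []) B n (≤-trans k≤B (m≤n+m B n))
iter-φ-empty-first {k} {B} 0<k k≤B (suc m) n = begin
  iter (φ k) (suc (suc m)) (suc (suc m) ∷ B ∷ blocks k n)
    ≡⟨ iter-suc (φ k) (suc m) _ ⟩
  iter (φ k) (suc m) (φ k (suc (suc m) ∷ B ∷ blocks k n))
    ≡⟨ cong (iter (φ k) (suc m)) (φ-feed 0<k (suc (suc m) ∷ []) B n (≤-trans k≤B (m≤n+m B n))) ⟩
  iter (φ k) (suc m) (suc m ∷ B ∷ blocks k (suc n))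
    ≡⟨ iter-φ-empty-first 0<k k≤B m (suc n) ⟩
  B ∷ blocks k (suc m + suc n)
    ≡⟨ cong (λ n → B ∷ blocks k n) (+-suc (suc m) n) ⟩
  B ∷ blocks k (suc (suc m) + n) ∎

Y-absorb : ∀ {k l} → 0 < k → ∀ j → k + j ≤ l → iter (φ k) j (Y l j) ≡ packed k l (l ∸ j)
Y-absorb {k} {l} _ zero _ = cong (λ n → l ∷ blocks k n) (sym (n∸n≡0 l))
Y-absorb {k} {l} 0<k (suc j) le = begin
  iter (φ k) (suc j) (suc j ∷ l ∸ suc j ∷ blocks k 0)
    ≡⟨ iter-φ-empty-first 0<k (m+n≤o⇒m≤o∸n k le) j 0 ⟩
  l ∸ suc j ∷ blocks k (suc j + 0)
    ≡⟨ cong (λ n → l ∸ suc j ∷ blocks k n) (trans (+-identityʳ (suc j)) (sym (m∸[m∸n]≡n j<l))) ⟩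
  packed k l (l ∸ suc j) ∎
  where
  j<l : suc j ≤ l
  j<l = ≤-trans (m≤n+m (suc j) k) le

Y-packed : ∀ {k l j} → 1 ≤ j → j < l → l ≤ k + j → Y l j ≡ packed k l j
Y-packed {k} {l} {suc j} _ j<l l≤k+j = cong (suc j ∷_) (sym (blocks-canonical 0 (l ∸ suc j) 1≤c c≤k))
  where
  1≤c = m<n⇒0<n∸m j<l
  c≤k = m≤n+o⇒m∸n≤o l (suc j) (subst (l ≤_) (+-comm k (suc j)) l≤k+j)

X-zero : ∀ {k l d r} → l ≡ k * suc d + r → 1 ≤ r → r ≤ k → X k (suc d) r 0 ≡ packed k l k
X-zero {k} {l} {d} {r} refl 1≤r r≤k = cong (k ∷_) (sym (begin
  blocks k (k * suc d + r ∸ k)    ≡⟨ cong (λ n → blocks k (n ∸ k)) (shuffle k d r) ⟩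
  blocks k (k + (d * k + r) ∸ k)  ≡⟨ cong (blocks k) (m+n∸m≡n k (d * k + r)) ⟩
  blocks k (d * k + r)            ≡⟨ blocks-canonical d r 1≤r r≤k ⟩
  replicate d k ++ r ∷ []         ∎))
  where
  shuffle : ∀ k d r → k * suc d + r ≡ k + (d * k + r)
  shuffle = solve-∀

X-suc : ∀ {k l d r i} → l ≡ k * suc d + r → 1 ≤ r → r ≤ k → suc i < k →
        X k (suc d) r (suc i) ≡ packed k l (suc i)
X-suc {k} {l} {d} {r} {i} refl 1≤r r≤k i<k with suc i <? r
... | yes i<r rewrite dec-true (suc i <? r) i<r = cong (suc i ∷_) (sym (begin
  blocks k (k * suc d + r ∸ suc i)
    ≡⟨ cong (blocks k) (+-∸-assoc (k * suc d) (<⇒≤ i<r)) ⟩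
  blocks k (k * suc d + (r ∸ suc i))
    ≡⟨ cong (λ n → blocks k (n + (r ∸ suc i))) (*-comm k (suc d)) ⟩
  blocks k (suc d * k + (r ∸ suc i))
    ≡⟨ blocks-canonical (suc d) (r ∸ suc i) (m<n⇒0<n∸m i<r) (≤-trans (m∸n≤m r (suc i)) r≤k) ⟩
  replicate (suc d) k ++ r ∸ suc i ∷ [] ∎))
... | no i≮r rewrite dec-false (suc i <? r) i≮r = cong (suc i ∷_) (sym (begin
  blocks k (k * suc d + r ∸ suc i)
    ≡⟨ cong (λ n → blocks k (n ∸ suc i)) (shuffle k d r) ⟩
  blocks k (d * k + (k + r) ∸ suc i)
    ≡⟨ cong (blocks k) (+-∸-assoc (d * k) (≤-trans (<⇒≤ i<k) (m≤m+n k r))) ⟩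
  blocks k (d * k + (k + r ∸ suc i))
    ≡⟨ blocks-canonical d (k + r ∸ suc i) (m<n⇒0<n∸m (≤-trans i<k (m≤m+n k r))) last≤k ⟩
  replicate d k ++ k + r ∸ suc i ∷ [] ∎))
  where
  shuffle : ∀ k d r → k * suc d + r ≡ d * k + (k + r)
  shuffle = solve-∀
  last≤k : k + r ∸ suc i ≤ k
  last≤k = m≤n+o⇒m∸n≤o (k + r) (suc i) (subst (k + r ≤_) (+-comm k (suc i)) (+-monoʳ-≤ k (≮⇒≥ i≮r)))

iter-φ-Y-near : ∀ {k d r} → 0 < k → 1 ≤ r → r ≤ k → ∀ j o → k + j + o ≡ k * suc d + r →
                iter (φ k) (k + j + o ∸ k) (Y (k + j + o) j) ≡ X k (suc d) r ((k + j) ∸ (k + j + o))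
iter-φ-Y-near {k} {d} {r} 0<k 1≤r r≤k j o hl = begin
  iter (φ k) (l ∸ k) (Y l j)           ≡⟨ cong (λ n → iter (φ k) n (Y l j)) steps ⟩
  iter (φ k) (o + j) (Y l j)           ≡⟨ iter-+ (φ k) o j (Y l j) ⟩
  iter (φ k) o (iter (φ k) j (Y l j))  ≡⟨ cong (iter (φ k) o) (Y-absorb 0<k j (m≤m+n (k + j) o)) ⟩
  iter (φ k) o (packed k l (l ∸ j))    ≡⟨ cong (λ x → iter (φ k) o (packed k l x)) first ⟩
  iter (φ k) o (packed k l (o + k))    ≡⟨ iter-φ-packed 0<k k≤l o k 0<k (subst (_≤ l) first (m∸n≤m l j)) ⟩
  packed k l k                         ≡⟨ X-zero hl 1≤r r≤k ⟨
  X k (suc d) r 0                      ≡⟨ cong (X k (suc d) r) (m≤n⇒m∸n≡0 (m≤m+n (k + j) o)) ⟨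
  X k (suc d) r ((k + j) ∸ l)          ∎
  where
  l = k + j + o
  k≤l : k ≤ l
  k≤l = ≤-trans (m≤m+n k j) (m≤m+n (k + j) o)
  steps : l ∸ k ≡ o + j
  steps = trans (cong (_∸ k) (+-assoc k j o)) (trans (m+n∸m≡n k (j + o)) (+-comm j o))
  shuffle : ∀ k j o → k + j + o ≡ j + (o + k)
  shuffle = solve-∀
  first : l ∸ j ≡ o + k
  first = trans (cong (_∸ j) (shuffle k j o)) (m+n∸m≡n j (o + k))

iter-φ-Y-far : ∀ {k d r} → 0 < k → 1 ≤ r → r ≤ k → ∀ o i → k + o ≡ k * suc d + r → suc (o + i) < k + o →
               iter (φ k) (k + o ∸ k) (Y (k + o) (suc (o + i))) ≡ X k (suc d) r ((k + suc (o + i)) ∸ (k + o))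
iter-φ-Y-far {k} {d} {r} 0<k 1≤r r≤k o i hl j<l = begin
  iter (φ k) (l ∸ k) (Y l j)             ≡⟨ cong₂ (iter (φ k)) (m+n∸m≡n k o) (Y-packed (s≤s z≤n) j<l l≤k+j) ⟩
  iter (φ k) o (packed k l j)            ≡⟨ cong (λ x → iter (φ k) o (packed k l x)) (+-suc o i) ⟨
  iter (φ k) o (packed k l (o + suc i))  ≡⟨ iter-φ-packed 0<k (m≤m+n k o) o (suc i) (s≤s z≤n) o+i<l ⟩
  packed k l (suc i)                     ≡⟨ X-suc hl 1≤r r≤k i<k ⟨
  X k (suc d) r (suc i)                  ≡⟨ cong (X k (suc d) r) index ⟨
  X k (suc d) r ((k + j) ∸ l)            ∎
  where
  l = k + o
  j = suc (o + i)
  l≤k+j : l ≤ k + j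
  l≤k+j = +-monoʳ-≤ k (≤-trans (m≤m+n o i) (n≤1+n (o + i)))
  o+i<l : o + suc i ≤ l
  o+i<l = subst (_≤ l) (sym (+-suc o i)) (<⇒≤ j<l)
  i<k : suc i < k
  i<k = +-cancelˡ-< o (suc i) k (subst₂ _<_ (sym (+-suc o i)) (+-comm k o) j<l)
  index : (k + j) ∸ l ≡ suc i
  index = trans ([m+n]∸[m+o]≡n∸o k j o) (trans (cong (_∸ o) (sym (+-suc o i))) (m+n∸m≡n o (suc i)))

iter-φ-Y : ∀ {k l d r} → 0 < k → k < l → 1 ≤ r → r ≤ k → l ≡ k * suc d + r →
           ∀ j → j < l → iter (φ k) (l ∸ k) (Y l j) ≡ X k (suc d) r ((k + j) ∸ l)
iter-φ-Y {k} {l} 0<k k<l 1≤r r≤k hl j j<l with k + j ≤? l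
... | yes k+j≤l with m≤n⇒∃[o]m+o≡n k+j≤l
...   | o , refl = iter-φ-Y-near 0<k 1≤r r≤k j o hl
iter-φ-Y {k} {l} 0<k k<l 1≤r r≤k hl j j<l | no k+j≰l with m≤n⇒∃[o]m+o≡n (<⇒≤ k<l)
...   | o , refl with m≤n⇒∃[o]m+o≡n (+-cancelˡ-< k o j (≰⇒> k+j≰l))
...     | i , refl = iter-φ-Y-far 0<k 1≤r r≤k o i hl j<l

lemma4 : (k l : ℕ) → 2 ≤ k → k < l →
    ((is : List ℕ) (ip : ℕ) → All (λ x → 1 ≤ x) (is ∷ʳ ip) → sum (is ∷ʳ ip) ≡ l →
      iter (φ l) (weight (is ∷ʳ ip)) (is ∷ʳ ip) ≡ Y l (l ∸ ip))
    ×
    ((d r : ℕ) → 1 ≤ d → 1 ≤ r → r ≤ k → l ≡ k * d + r →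
      (j : ℕ) → j < l →
      iter (φ k) (l ∸ k) (Y l j) ≡ X k d r ((k + j) ∸ l))
lemma4 k l 2≤k k<l = iter-φ-weight , λ where
  (suc d) r (s≤s z≤n) 1≤r r≤k hl → iter-φ-Y (≤-trans (s≤s z≤n) 2≤k) k<l 1≤r r≤k hl
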